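{- Let $S$ be a state reachable from a clusteron. If $S$ has two distinct gaps of size $2$, then strictly between these two gaps there are two adjacent rooms that are both occupied.
   Context: Rooms are indexed by the integers, room $i$ adjacent to rooms $i\pm1$. A state is a function $a:\mathbb{Z}\to\mathbb{Z}_{\ge0}$ with finite support ($a_i$ = number of indistinguishable violinists in room $i$; several may share a room); room $i$ is occupied if $a_i\ge1$. A move is possible whenever two adjacent rooms $i,i+1$ are both occupied: one violinist leaves room $i$ for the nearest unoccupied room to the left of $i$, and one violinist leaves room $i+1$ for the nearest unoccupied room to the right of $i+1$. Reachable means obtained by a finite (possibly empty) sequence of moves. A clusteron is a state whose occupied rooms form a nonempty set of consecutive rooms. If $p<q$ are occupied rooms with no occupied room strictly between them, the set of $q-p-1$ empty rooms between them is a gap of size $q-p-1$. -}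

module Defs where

open import Data.Nat as ℕ using (ℕ)
open import Data.Integer using (ℤ; _+_; _<_; _≤_; ∣_∣; _≟_; +_)
open import Data.Product using (Σ; ∃; _×_; _,_)
open import Data.Bool using (if_then_else_)
open import Relation.Nullary.Decidable using (⌊_⌋)
open import Relation.Binary.PropositionalEquality using (_≡_)
open import Relation.Binary.Construct.Closure.ReflexiveTransitive using (Star)
open import Function.Bundles using (_⇔_)

-- A state: number of violinists in each room (finite support required separately).
State : Set
State = ℤ → ℕ

FinSupp : State → Set
FinSupp a = ∃ λ (N : ℕ) → ∀ i → N ℕ.< ∣ i ∣ → a i ≡ 0

Occupied : State → ℤ → Set
Occupied a i = 1 ℕ.≤ a i

Empty : State → ℤ → Set
Empty a i = a i ≡ 0

δ : ℤ → ℤ → ℕ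
δ x j = if ⌊ x ≟ j ⌋ then 1 else 0

-- One move at the adjacent occupied rooms i, i+1: L is the nearest unoccupied
-- room left of i, R the nearest unoccupied room right of i+1; one violinist
-- goes i → L and one goes i+1 → R.
Move : State → State → Set
Move a b = ∃ λ (i : ℤ) → ∃ λ (L : ℤ) → ∃ λ (R : ℤ) →
    Occupied a i × Occupied a (i + + 1)
  × L < i × Empty a L × (∀ j → L < j → j < i → Occupied a j)
  × i + + 1 < R × Empty a R × (∀ j → i + + 1 < j → j < R → Occupied a j)
  × (∀ j → b j ℕ.+ δ i j ℕ.+ δ (i + + 1) j ≡ a j ℕ.+ δ L j ℕ.+ δ R j)

Reachable : State → State → Set
Reachable = Star Move

Clusteron : State → Set
Clusteron a = FinSupp a × ∃ λ (p : ℤ) → ∃ λ (q : ℤ) →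
  p ≤ q × (∀ i → (p ≤ i × i ≤ q) ⇔ Occupied a i)

Gap2At : State → ℤ → Set
Gap2At a p = Occupied a p × Empty a (p + + 1) × Empty a (p + + 2) × Occupied a (p + + 3)

module Submission where

-- Two properties of a state are preserved by moves and hold in a clusteron:
-- no gap has size 3 or more, and between any two 2-gaps there are two adjacent
-- occupied rooms (the conclusion of the theorem).  A move at i, i+1 with destinations L and R
-- leaves L, …, i-1 and i+2, …, R occupied, so the only 2-gap it can create is
-- {i, i+1}; every other 2-gap was already a 2-gap.  If the new gap {i, i+1}
-- lies left of an old 2-gap q, the pair R, R+1 separates them unless R+1 was
-- empty; then R+2 was occupied (no 3-gaps), so R-1 started a 2-gap before the
-- move and the second property before the move separates it from q.  The case
-- of a new gap right of an old one is symmetric, through L-1, L.  If a pair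
-- separating two old 2-gaps contains i or i+1, the second gap lies beyond R and
-- the same argument applies.

open import Defs
open import Data.Nat as ℕ using (ℕ; suc; z≤n; s≤s)
import Data.Nat.Properties as ℕP
open import Data.Integer as ℤ using (ℤ; _+_; _<_; _≤_; +_; +<+)
import Data.Integer.Properties as ℤP
open import Data.Empty using (⊥; ⊥-elim)
open import Data.Sum using (_⊎_; inj₁; inj₂; [_,_]′)
open import Data.Product using (∃; _×_; _,_; proj₁; proj₂)
open import Function.Base using (_∘_)
open import Function.Bundles using (Equivalence)
open import Relation.Binary using (tri<; tri≈; tri>)
open import Relation.Binary.PropositionalEquality
open import Relation.Binary.Construct.Closure.ReflexiveTransitive using (ε; _◅_)
open import Relation.Nullary using (yes; no)

shift-shift : ∀ i m n → i + + m + + n ≡ i + + (m ℕ.+ n)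
shift-shift i m n = ℤP.+-assoc i (+ m) (+ n)

i<i+[1+n] : ∀ i n → i < i + + suc n
i<i+[1+n] i n = subst (_< i + + suc n) (ℤP.+-identityʳ i) (ℤP.+-monoʳ-< i (+<+ (s≤s z≤n)))

i<i+1 : ∀ i → i < i + + 1
i<i+1 i = i<i+[1+n] i 0

i+n<i+[1+n] : ∀ i n → i + + n < i + + suc n
i+n<i+[1+n] i n = ℤP.+-monoʳ-< i (+<+ (ℕP.n<1+n n))

pred[i]+1≡i : ∀ i → ℤ.pred i + + 1 ≡ i
pred[i]+1≡i i = trans (ℤP.+-comm (ℤ.pred i) (+ 1)) (ℤP.suc-pred i)

i<j⇒i+1≤j : ∀ {i j} → i < j → i + + 1 ≤ j
i<j⇒i+1≤j {i} i<j = subst (_≤ _) (ℤP.+-comm (+ 1) i) (ℤP.i<j⇒suc[i]≤j i<j)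

no-room-between : ∀ {i j} → i < j → j < i + + 1 → ⊥
no-room-between i<j j<i+1 = ℤP.<-irrefl refl (ℤP.<-≤-trans j<i+1 (i<j⇒i+1≤j i<j))

i<j+1⇒i≤j : ∀ {i j} → i < j + + 1 → i ≤ j
i<j+1⇒i≤j i<j+1 = ℤP.≮⇒≥ (λ j<i → no-room-between j<i i<j+1)

>⇒≢ : ∀ {i j : ℤ} → j < i → i ≢ j
>⇒≢ = ≢-sym ∘ ℤP.<⇒≢

δ-diag : ∀ x → δ x x ≡ 1
δ-diag x with x ℤ.≟ x
... | yes _ = refl
... | no x≢x = ⊥-elim (x≢x refl)

δ-off : ∀ {x j} → j ≢ x → δ x j ≡ 0
δ-off {x} {j} j≢x with x ℤ.≟ j
... | yes x≡j = ⊥-elim (j≢x (sym x≡j))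
... | no _ = refl

drop-zeros : ∀ {x y u v : ℕ} → u ≡ 0 → v ≡ 0 → x ℕ.+ u ℕ.+ v ≡ y → x ≡ y
drop-zeros {x} refl refl x+0+0≡y =
  trans (sym (trans (ℕP.+-identityʳ (x ℕ.+ 0)) (ℕP.+-identityʳ x))) x+0+0≡y

m≤m+n+o : ∀ m n o → m ℕ.≤ m ℕ.+ n ℕ.+ o
m≤m+n+o m n o = ℕP.≤-trans (ℕP.m≤m+n m n) (ℕP.m≤m+n (m ℕ.+ n) o)

occupied-or-empty : ∀ a j → Occupied a j ⊎ Empty a j
occupied-or-empty a j with a j
... | ℕ.zero = inj₂ refl
... | suc _ = inj₁ (s≤s z≤n)

OccupiedPairIn : State → ℤ → ℤ → Set
OccupiedPairIn a lo hi = ∃ λ (j : ℤ) → lo ≤ j × j + + 1 ≤ hi × Occupied a j × Occupied a (j + + 1)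

OccupiedPairIn-mono : ∀ {a lo lo′ hi hi′} → lo′ ≤ lo → hi ≤ hi′ →
  OccupiedPairIn a lo hi → OccupiedPairIn a lo′ hi′
OccupiedPairIn-mono lo′≤lo hi≤hi′ (j , lo≤j , j+1≤hi , oj , oj+1) =
  j , ℤP.≤-trans lo′≤lo lo≤j , ℤP.≤-trans j+1≤hi hi≤hi′ , oj , oj+1

GapsAtMostTwo : State → Set
GapsAtMostTwo a = ∀ x z y → Occupied a x → Occupied a y → x < z → z + + 2 < y →
  Empty a z → Empty a (z + + 1) → Empty a (z + + 2) → ⊥

Gap2sSeparated : State → Set
Gap2sSeparated a = ∀ p₁ p₂ → p₁ < p₂ → Gap2At a p₁ → Gap2At a p₂ →
  OccupiedPairIn a (p₁ + + 3) p₂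

gap2-from-successors : ∀ {a} m → Occupied a m → Empty a (m + + 1) → Empty a (m + + 1 + + 1) →
  Occupied a (m + + 1 + + 1 + + 1) → Gap2At a m
gap2-from-successors {a} m om e₁ e₂ o₃ =
  om , e₁ , subst (Empty a) (shift-shift m 1 1) e₂ ,
  subst (Occupied a) (trans (cong (_+ + 1) (shift-shift m 1 1)) (shift-shift m 2 1)) o₃

module MoveFacts {a b : State} {i L R : ℤ}
  (oᵢ : Occupied a i) (oᵢ₊₁ : Occupied a (i + + 1))
  (L<i : L < i) (eL : Empty a L) (between-L-i : ∀ j → L < j → j < i → Occupied a j)
  (i+1<R : i + + 1 < R) (eR : Empty a R) (between-i+1-R : ∀ j → i + + 1 < j → j < R → Occupied a j)
  (transfer : ∀ j → b j ℕ.+ δ i j ℕ.+ δ (i + + 1) j ≡ a j ℕ.+ δ L j ℕ.+ δ R j)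
  where

  L<i+1 : L < i + + 1
  L<i+1 = ℤP.<-trans L<i (i<i+1 i)

  i<R : i < R
  i<R = ℤP.<-trans (i<i+1 i) i+1<R

  L<R : L < R
  L<R = ℤP.<-trans L<i i<R

  a≤b : ∀ {j} → j ≢ i → j ≢ i + + 1 → a j ℕ.≤ b j
  a≤b {j} j≢i j≢i+1 =
    subst (a j ℕ.≤_) (sym (drop-zeros (δ-off j≢i) (δ-off j≢i+1) (transfer j)))
      (m≤m+n+o (a j) (δ L j) (δ R j))

  b≤a : ∀ {j} → j ≢ L → j ≢ R → b j ℕ.≤ a j
  b≤a {j} j≢L j≢R =
    subst (b j ℕ.≤_) (sym (drop-zeros (δ-off j≢L) (δ-off j≢R) (sym (transfer j))))
      (m≤m+n+o (b j) (δ i j) (δ (i + + 1) j))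

  a≤b-left : ∀ {j} → j < i → a j ℕ.≤ b j
  a≤b-left j<i = a≤b (ℤP.<⇒≢ j<i) (ℤP.<⇒≢ (ℤP.<-trans j<i (i<i+1 i)))

  a≤b-right : ∀ {j} → i + + 1 < j → a j ℕ.≤ b j
  a≤b-right i+1<j = a≤b (>⇒≢ (ℤP.<-trans (i<i+1 i) i+1<j)) (>⇒≢ i+1<j)

  kept-left : ∀ {j} → j < i → Occupied a j → Occupied b j
  kept-left j<i oj = ℕP.≤-trans oj (a≤b-left j<i)

  kept-right : ∀ {j} → i + + 1 < j → Occupied a j → Occupied b j
  kept-right i+1<j oj = ℕP.≤-trans oj (a≤b-right i+1<j)

  empty-before-left : ∀ {j} → j < L → Empty b j → Empty a j
  empty-before-left {j} j<L e = ℕP.n≤0⇒n≡0 (subst (a j ℕ.≤_) e (a≤b-left (ℤP.<-trans j<L L<i)))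

  empty-before-right : ∀ {j} → R < j → Empty b j → Empty a j
  empty-before-right {j} R<j e = ℕP.n≤0⇒n≡0 (subst (a j ℕ.≤_) e (a≤b-right (ℤP.<-trans i+1<R R<j)))

  occupied-before : ∀ {j} → j ≢ L → j ≢ R → Occupied b j → Occupied a j
  occupied-before j≢L j≢R oj = ℕP.≤-trans oj (b≤a j≢L j≢R)

  occupied-before-left : ∀ {j} → j < L → Occupied b j → Occupied a j
  occupied-before-left j<L = occupied-before (ℤP.<⇒≢ j<L) (ℤP.<⇒≢ (ℤP.<-trans j<L L<R))

  occupied-before-right : ∀ {j} → R < j → Occupied b j → Occupied a j
  occupied-before-right R<j = occupied-before (>⇒≢ (ℤP.<-trans L<R R<j)) (>⇒≢ R<j)

  occupied-L : Occupied b L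
  occupied-L =
    subst (1 ℕ.≤_) (sym (drop-zeros (δ-off (ℤP.<⇒≢ L<i)) (δ-off (ℤP.<⇒≢ L<i+1)) (transfer L)))
    (subst (λ d → 1 ℕ.≤ a L ℕ.+ d ℕ.+ δ R L) (sym (δ-diag L))
      (ℕP.≤-trans (ℕP.m≤n+m 1 (a L)) (ℕP.m≤m+n (a L ℕ.+ 1) (δ R L))))

  occupied-R : Occupied b R
  occupied-R = subst (1 ℕ.≤_) (sym (drop-zeros (δ-off (>⇒≢ i<R)) (δ-off (>⇒≢ i+1<R)) (transfer R)))
    (subst (λ d → 1 ℕ.≤ a R ℕ.+ δ L R ℕ.+ d) (sym (δ-diag R)) (ℕP.m≤n+m 1 (a R ℕ.+ δ L R)))

  occupied-left-block : ∀ j → L ≤ j → j < i → Occupied b j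
  occupied-left-block j L≤j j<i with ℤP.<-cmp L j
  ... | tri< L<j _ _ = kept-left j<i (between-L-i j L<j j<i)
  ... | tri≈ _ refl _ = occupied-L
  ... | tri> _ _ j<L = ⊥-elim (ℤP.<-irrefl refl (ℤP.<-≤-trans j<L L≤j))

  occupied-right-block : ∀ j → i + + 1 < j → j ≤ R → Occupied b j
  occupied-right-block j i+1<j j≤R with ℤP.<-cmp j R
  ... | tri< j<R _ _ = kept-right i+1<j (between-i+1-R j i+1<j j<R)
  ... | tri≈ _ refl _ = occupied-R
  ... | tri> _ _ R<j = ⊥-elim (ℤP.<-irrefl refl (ℤP.<-≤-trans R<j j≤R))

  adjacent-empties : ∀ w → Empty b w → Empty b (w + + 1) → w + + 1 < L ⊎ w ≡ i ⊎ R < w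
  adjacent-empties w e₀ e₁ with ℤP.<-cmp (w + + 1) L | ℤP.<-cmp w i | ℤP.<-cmp R w
  ... | tri< w+1<L _ _ | _ | _ = inj₁ w+1<L
  ... | _ | tri≈ _ w≡i _ | _ = inj₂ (inj₁ w≡i)
  ... | _ | _ | tri< R<w _ _ = inj₂ (inj₂ R<w)
  ... | tri≈ _ w+1≡L _ | _ | _ = ⊥-elim (ℕP.n>0⇒n≢0 (subst (Occupied b) (sym w+1≡L) occupied-L) e₁)
  ... | tri> _ _ L<w+1 | tri< w<i _ _ | _ =
    ⊥-elim (ℕP.n>0⇒n≢0 (occupied-left-block w (i<j+1⇒i≤j L<w+1) w<i) e₀)
  ... | tri> _ _ _ | tri> _ _ _ | tri≈ _ R≡w _ = ⊥-elim (ℕP.n>0⇒n≢0 (subst (Occupied b) R≡w occupied-R) e₀)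
  ... | tri> _ _ _ | tri> _ _ i<w | tri> _ _ w<R with ℤP.<-cmp (i + + 1) w
  ...   | tri< i+1<w _ _ = ⊥-elim (ℕP.n>0⇒n≢0 (occupied-right-block w i+1<w (ℤP.<⇒≤ w<R)) e₀)
  ...   | tri≈ _ refl _ = ⊥-elim (ℕP.n>0⇒n≢0 (occupied-right-block (w + + 1) (i<i+1 w) (i<j⇒i+1≤j w<R)) e₁)
  ...   | tri> _ _ w<i+1 = ⊥-elim (no-room-between i<w w<i+1)

  GapsAtMostTwo-preserved : GapsAtMostTwo a → GapsAtMostTwo b
  GapsAtMostTwo-preserved gaps≤2 x z y ox oy x<z z+2<y e₀ e₁ e₂
    with adjacent-empties (z + + 1) e₁ (subst (Empty b) (sym (shift-shift z 1 1)) e₂)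
  ... | inj₁ z+1+1<L = gaps≤2 x z i (occupied-before-left x<L ox) oᵢ x<z (ℤP.<-trans z+2<L L<i)
        (empty-before-left z<L e₀) (empty-before-left z+1<L e₁) (empty-before-left z+2<L e₂)
    where
    z+2<L : z + + 2 < L
    z+2<L = subst (_< L) (shift-shift z 1 1) z+1+1<L
    z+1<L : z + + 1 < L
    z+1<L = ℤP.<-trans (i+n<i+[1+n] z 1) z+2<L
    z<L : z < L
    z<L = ℤP.<-trans (i<i+1 z) z+1<L
    x<L : x < L
    x<L = ℤP.<-trans x<z z<L
  ... | inj₂ (inj₁ z+1≡i) with adjacent-empties z e₀ e₁
  ...   | inj₁ z+1<L = ⊥-elim (ℤP.<-asym L<i (subst (_< L) z+1≡i z+1<L))
  ...   | inj₂ (inj₁ z≡i) = ⊥-elim (ℤP.<-irrefl (trans z≡i (sym z+1≡i)) (i<i+1 z))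
  ...   | inj₂ (inj₂ R<z) = ⊥-elim (ℤP.<-asym i<R (subst (R <_) z+1≡i (ℤP.<-trans R<z (i<i+1 z))))
  GapsAtMostTwo-preserved gaps≤2 x z y ox oy x<z z+2<y e₀ e₁ e₂ | inj₂ (inj₂ R<z+1)
    with adjacent-empties z e₀ e₁
  ...   | inj₁ z+1<L = ⊥-elim (ℤP.<-asym L<R (ℤP.<-trans R<z+1 z+1<L))
  ...   | inj₂ (inj₁ refl) = ⊥-elim (ℤP.<-asym i+1<R R<z+1)
  ...   | inj₂ (inj₂ R<z) =
        gaps≤2 (i + + 1) z y oᵢ₊₁ (occupied-before-right R<y oy) (ℤP.<-trans i+1<R R<z) z+2<y
        (empty-before-right R<z e₀) (empty-before-right R<z+1 e₁) (empty-before-right R<z+2 e₂)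
    where
    R<z+2 : R < z + + 2
    R<z+2 = ℤP.<-trans R<z+1 (i+n<i+[1+n] z 1)
    R<y : R < y
    R<y = ℤP.<-trans R<z+2 z+2<y

  pair-kept : ∀ {lo hi} j → j + + 1 < i ⊎ i + + 1 < j → lo ≤ j → j + + 1 ≤ hi →
    Occupied a j → Occupied a (j + + 1) → OccupiedPairIn b lo hi
  pair-kept j (inj₁ j+1<i) lo≤j j+1≤hi oj oj+1 =
    j , lo≤j , j+1≤hi , kept-left (ℤP.<-trans (i<i+1 j) j+1<i) oj , kept-left j+1<i oj+1
  pair-kept j (inj₂ i+1<j) lo≤j j+1≤hi oj oj+1 =
    j , lo≤j , j+1≤hi , kept-right i+1<j oj , kept-right (ℤP.<-trans i+1<j (i<i+1 j)) oj+1

  gap2-new-or-old : GapsAtMostTwo a → ∀ p → Gap2At b p → p + + 1 ≡ i ⊎ Gap2At a p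
  gap2-new-or-old gaps≤2 p (oₚ , e₁ , e₂ , o₃)
    with adjacent-empties (p + + 1) e₁ (subst (Empty b) (sym (shift-shift p 1 1)) e₂)
  ... | inj₂ (inj₁ p+1≡i) = inj₁ p+1≡i
  ... | inj₁ p+1+1<L = inj₂ (oₚᵃ , e₁ᵃ , e₂ᵃ , o₃ᵃ)
    where
    p+2<L : p + + 2 < L
    p+2<L = subst (_< L) (shift-shift p 1 1) p+1+1<L
    p+1<L : p + + 1 < L
    p+1<L = ℤP.<-trans (i+n<i+[1+n] p 1) p+2<L
    p<L : p < L
    p<L = ℤP.<-trans (i<i+1 p) p+1<L
    oₚᵃ : Occupied a p
    oₚᵃ = occupied-before-left p<L oₚ
    e₁ᵃ : Empty a (p + + 1)
    e₁ᵃ = empty-before-left p+1<L e₁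
    e₂ᵃ : Empty a (p + + 2)
    e₂ᵃ = empty-before-left p+2<L e₂
    o₃ᵃ : Occupied a (p + + 3)
    o₃ᵃ with ℤP.<-cmp (p + + 3) L
    ... | tri< p+3<L _ _ = occupied-before-left p+3<L o₃
    ... | tri≈ _ p+3≡L _ = ⊥-elim (gaps≤2 p (p + + 1) i oₚᵃ oᵢ (i<i+1 p) (subst (_< i) (sym p+1+2≡L) L<i)
          e₁ᵃ (subst (Empty a) (sym (shift-shift p 1 1)) e₂ᵃ) (subst (Empty a) (sym p+1+2≡L) eL))
      where
      p+1+2≡L : p + + 1 + + 2 ≡ L
      p+1+2≡L = trans (shift-shift p 1 2) p+3≡L
    ... | tri> _ _ L<p+3 = ⊥-elim (no-room-between p+2<L (subst (L <_) (sym (shift-shift p 2 1)) L<p+3))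
  ... | inj₂ (inj₂ R<p+1) = inj₂ (oₚᵃ , e₁ᵃ , e₂ᵃ , o₃ᵃ)
    where
    R<p+2 : R < p + + 2
    R<p+2 = ℤP.<-trans R<p+1 (i+n<i+[1+n] p 1)
    R<p+3 : R < p + + 3
    R<p+3 = ℤP.<-trans R<p+2 (i+n<i+[1+n] p 2)
    e₁ᵃ : Empty a (p + + 1)
    e₁ᵃ = empty-before-right R<p+1 e₁
    e₂ᵃ : Empty a (p + + 2)
    e₂ᵃ = empty-before-right R<p+2 e₂
    o₃ᵃ : Occupied a (p + + 3)
    o₃ᵃ = occupied-before-right R<p+3 o₃
    oₚᵃ : Occupied a p
    oₚᵃ with ℤP.<-cmp R p
    ... | tri< R<p _ _ = occupied-before-right R<p oₚ
    ... | tri≈ _ refl _ =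
      ⊥-elim (gaps≤2 (i + + 1) R (R + + 3) oᵢ₊₁ o₃ᵃ i+1<R (i+n<i+[1+n] R 2) eR e₁ᵃ e₂ᵃ)
    ... | tri> _ _ p<R = ⊥-elim (no-room-between p<R R<p+1)

  pair-kept-right : ∀ {lo hi} → i + + 1 < lo → OccupiedPairIn a lo hi → OccupiedPairIn b lo hi
  pair-kept-right i+1<lo (j , lo≤j , j+1≤hi , oj , oj+1) =
    pair-kept j (inj₂ (ℤP.<-≤-trans i+1<lo lo≤j)) lo≤j j+1≤hi oj oj+1

  pair-kept-left : ∀ {lo hi} → hi < i → OccupiedPairIn a lo hi → OccupiedPairIn b lo hi
  pair-kept-left hi<i (j , lo≤j , j+1≤hi , oj , oj+1) =
    pair-kept j (inj₁ (ℤP.≤-<-trans j+1≤hi hi<i)) lo≤j j+1≤hi oj oj+1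

  surviving-gap2-right-of-move : ∀ q → Gap2At a q → Empty b (q + + 1) → i ≤ q → R < q
  surviving-gap2-right-of-move q (o_q , e₁ , _ , _) eᵇ₁ i≤q =
    ℤP.≤∧≢⇒< (i<j+1⇒i≤j R<q+1) (λ { refl → ℕP.n>0⇒n≢0 o_q eR })
    where
    i<q : i < q
    i<q = ℤP.≤∧≢⇒< i≤q (λ { refl → ℕP.n>0⇒n≢0 oᵢ₊₁ e₁ })
    R<q+1 : R < q + + 1
    R<q+1 with ℤP.<-cmp R (q + + 1)
    ... | tri< R<q+1 _ _ = R<q+1
    ... | tri≈ _ R≡q+1 _ = ⊥-elim (ℕP.n>0⇒n≢0 (subst (Occupied b) R≡q+1 occupied-R) eᵇ₁)
    ... | tri> _ _ q+1<R = ⊥-elim (ℕP.n>0⇒n≢0 (between-i+1-R (q + + 1) (ℤP.+-monoˡ-< (+ 1) i<q) q+1<R) e₁)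

  gap2-before-R : Empty a (R + + 1) → Occupied a (R + + 2) → Gap2At a (ℤ.pred R)
  gap2-before-R e_R+1 o_R+2 = gap2-from-successors {a} m oₘ (subst (Empty a) (sym m+1≡R) eR)
    (subst (λ x → Empty a (x + + 1)) (sym m+1≡R) e_R+1)
    (subst (λ x → Occupied a (x + + 1 + + 1)) (sym m+1≡R) (subst (Occupied a) (sym (shift-shift R 1 1)) o_R+2))
    where
    m : ℤ
    m = ℤ.pred R
    m+1≡R : m + + 1 ≡ R
    m+1≡R = pred[i]+1≡i R
    oₘ : Occupied a m
    oₘ with ℤP.<-cmp (i + + 1) m
    ... | tri< i+1<m _ _ = between-i+1-R m i+1<m (subst (m <_) m+1≡R (i<i+1 m))
    ... | tri≈ _ i+1≡m _ = subst (Occupied a) i+1≡m oᵢ₊₁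
    ... | tri> _ _ m<i+1 = ⊥-elim (no-room-between m<i+1 (subst (i + + 1 <_) (sym m+1≡R) i+1<R))

  pair-right-of-move : GapsAtMostTwo a → Gap2sSeparated a → ∀ q → Gap2At a q → R < q → OccupiedPairIn b R q
  pair-right-of-move gaps≤2 sep q gap R<q with occupied-or-empty a (R + + 1) | occupied-or-empty a (R + + 2)
  ... | inj₁ o_R+1 | _ =
    R , ℤP.≤-refl , i<j⇒i+1≤j R<q , occupied-R , kept-right (ℤP.<-trans i+1<R (i<i+1 R)) o_R+1
  ... | inj₂ e_R+1 | inj₂ e_R+2 =
    ⊥-elim (gaps≤2 i R (q + + 3) oᵢ (proj₂ (proj₂ (proj₂ gap))) i<R R+2<q+3 eR e_R+1 e_R+2)
    where
    R+2<q+3 : R + + 2 < q + + 3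
    R+2<q+3 = ℤP.<-trans (ℤP.+-monoˡ-< (+ 2) R<q) (i+n<i+[1+n] q 2)
  ... | inj₂ e_R+1 | inj₁ o_R+2 = OccupiedPairIn-mono (ℤP.<⇒≤ R<m+3) ℤP.≤-refl
          (pair-kept-right (ℤP.<-trans i+1<R R<m+3) (sep m q (ℤP.<-trans m<R R<q) (gap2-before-R e_R+1 o_R+2) gap))
    where
    m : ℤ
    m = ℤ.pred R
    m<R : m < R
    m<R = subst (m <_) (pred[i]+1≡i R) (i<i+1 m)
    R<m+3 : R < m + + 3
    R<m+3 = subst (R <_) (trans (cong (_+ + 2) (sym (pred[i]+1≡i R))) (shift-shift m 1 2)) (i<i+[1+n] R 1)

  surviving-gap2-left-of-move : ∀ q → Gap2At a q → Empty b (q + + 2) → q + + 2 ≤ i → q + + 3 < L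
  surviving-gap2-left-of-move q (_ , _ , e₂ , o₃) eᵇ₂ q+2≤i =
    ℤP.≤∧≢⇒< q+3≤L (λ q+3≡L → ℕP.n>0⇒n≢0 (subst (Occupied a) q+3≡L o₃) eL)
    where
    q+2<i : q + + 2 < i
    q+2<i = ℤP.≤∧≢⇒< q+2≤i (λ q+2≡i → ℕP.n>0⇒n≢0 (subst (Occupied a) (sym q+2≡i) oᵢ) e₂)
    q+2<L : q + + 2 < L
    q+2<L with ℤP.<-cmp L (q + + 2)
    ... | tri< L<q+2 _ _ = ⊥-elim (ℕP.n>0⇒n≢0 (between-L-i (q + + 2) L<q+2 q+2<i) e₂)
    ... | tri≈ _ L≡q+2 _ = ⊥-elim (ℕP.n>0⇒n≢0 (subst (Occupied b) L≡q+2 occupied-L) eᵇ₂)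
    ... | tri> _ _ q+2<L = q+2<L
    q+3≤L : q + + 3 ≤ L
    q+3≤L = subst (_≤ L) (shift-shift q 2 1) (i<j⇒i+1≤j q+2<L)

  gap2-before-L : Occupied a (ℤ.pred (ℤ.pred L)) → Empty a (ℤ.pred L) → Gap2At a (ℤ.pred (ℤ.pred L))
  gap2-before-L oₘ eₗ = gap2-from-successors {a} m oₘ (subst (Empty a) (sym m+1≡l) eₗ)
    (subst (Empty a) (sym m+1+1≡L) eL) (subst (Occupied a) (sym (cong (_+ + 1) m+1+1≡L)) o_L+1)
    where
    l : ℤ
    l = ℤ.pred L
    m : ℤ
    m = ℤ.pred l
    m+1≡l : m + + 1 ≡ l
    m+1≡l = pred[i]+1≡i l
    m+1+1≡L : m + + 1 + + 1 ≡ L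
    m+1+1≡L = trans (cong (_+ + 1) m+1≡l) (pred[i]+1≡i L)
    o_L+1 : Occupied a (L + + 1)
    o_L+1 with ℤP.<-cmp (L + + 1) i
    ... | tri< L+1<i _ _ = between-L-i (L + + 1) (i<i+1 L) L+1<i
    ... | tri≈ _ L+1≡i _ = subst (Occupied a) (sym L+1≡i) oᵢ
    ... | tri> _ _ i<L+1 = ⊥-elim (no-room-between L<i i<L+1)

  pair-left-of-move : GapsAtMostTwo a → Gap2sSeparated a → ∀ q → Gap2At a q → q + + 3 < L →
    OccupiedPairIn b (q + + 3) L
  pair-left-of-move gaps≤2 sep q gap@(_ , _ , _ , o₃) q+3<L =
    [ pair-ending-at-L
    , (λ eₗ → [ pair-before-gap2 eₗ , ⊥-elim ∘ triple-gap eₗ ]′ (occupied-or-empty a m))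
    ]′ (occupied-or-empty a l)
    where
    l : ℤ
    l = ℤ.pred L
    m : ℤ
    m = ℤ.pred l
    l+1≡L : l + + 1 ≡ L
    l+1≡L = pred[i]+1≡i L
    m+1≡l : m + + 1 ≡ l
    m+1≡l = pred[i]+1≡i l
    m+2≡L : m + + 2 ≡ L
    m+2≡L = trans (sym (shift-shift m 1 1)) (trans (cong (_+ + 1) m+1≡l) l+1≡L)
    l<L : l < L
    l<L = subst (l <_) l+1≡L (i<i+1 l)
    m<L : m < L
    m<L = ℤP.<-trans (subst (m <_) m+1≡l (i<i+1 m)) l<L
    q+3≤l : q + + 3 ≤ l
    q+3≤l = i<j+1⇒i≤j (subst (q + + 3 <_) (sym l+1≡L) q+3<L)
    q+3≤m : Empty a l → q + + 3 ≤ m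
    q+3≤m eₗ = i<j+1⇒i≤j (subst (q + + 3 <_) (sym m+1≡l)
      (ℤP.≤∧≢⇒< q+3≤l (λ q+3≡l → ℕP.n>0⇒n≢0 (subst (Occupied a) q+3≡l o₃) eₗ)))
    pair-ending-at-L : Occupied a l → OccupiedPairIn b (q + + 3) L
    pair-ending-at-L oₗ = l , q+3≤l , ℤP.≤-reflexive l+1≡L , kept-left (ℤP.<-trans l<L L<i) oₗ ,
      subst (Occupied b) (sym l+1≡L) occupied-L
    pair-before-gap2 : Empty a l → Occupied a m → OccupiedPairIn b (q + + 3) L
    pair-before-gap2 eₗ oₘ = OccupiedPairIn-mono ℤP.≤-refl (ℤP.<⇒≤ m<L)
      (pair-kept-left (ℤP.<-trans m<L L<i)
        (sep q m (ℤP.<-≤-trans (i<i+[1+n] q 2) (q+3≤m eₗ)) gap (gap2-before-L oₘ eₗ)))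
    triple-gap : Empty a l → Empty a m → ⊥
    triple-gap eₗ eₘ = gaps≤2 (q + + 3) m i o₃ oᵢ
      (ℤP.≤∧≢⇒< (q+3≤m eₗ) (λ q+3≡m → ℕP.n>0⇒n≢0 (subst (Occupied a) q+3≡m o₃) eₘ))
      (subst (_< i) (sym m+2≡L) L<i) eₘ (subst (Empty a) (sym m+1≡l) eₗ) (subst (Empty a) (sym m+2≡L) eL)

  Gap2sSeparated-preserved : GapsAtMostTwo a → Gap2sSeparated a → Gap2sSeparated b
  Gap2sSeparated-preserved gaps≤2 sep p₁ p₂ p₁<p₂ g₁@(_ , _ , eᵇ[p₁+2] , _) g₂@(_ , eᵇ[p₂+1] , _ , _)
    with gap2-new-or-old gaps≤2 p₁ g₁ | gap2-new-or-old gaps≤2 p₂ g₂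
  ... | inj₁ p₁+1≡i | inj₁ p₂+1≡i =
    ⊥-elim (ℤP.<-irrefl (trans p₁+1≡i (sym p₂+1≡i)) (ℤP.+-monoˡ-< (+ 1) p₁<p₂))
  ... | inj₁ p₁+1≡i | inj₂ old₂ =
    OccupiedPairIn-mono p₁+3≤R ℤP.≤-refl
      (pair-right-of-move gaps≤2 sep p₂ old₂ (surviving-gap2-right-of-move p₂ old₂ eᵇ[p₂+1] i≤p₂))
    where
    i≤p₂ : i ≤ p₂
    i≤p₂ = subst (_≤ p₂) p₁+1≡i (i<j⇒i+1≤j p₁<p₂)
    p₁+3≤R : p₁ + + 3 ≤ R
    p₁+3≤R = subst (_≤ R)
      (trans (cong (λ x → x + + 1 + + 1) (sym p₁+1≡i)) (trans (shift-shift (p₁ + + 1) 1 1) (shift-shift p₁ 1 2)))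
      (i<j⇒i+1≤j i+1<R)
  ... | inj₂ old₁ | inj₁ p₂+1≡i =
    OccupiedPairIn-mono ℤP.≤-refl L≤p₂
      (pair-left-of-move gaps≤2 sep p₁ old₁ (surviving-gap2-left-of-move p₁ old₁ eᵇ[p₁+2] p₁+2≤i))
    where
    L≤p₂ : L ≤ p₂
    L≤p₂ = i<j+1⇒i≤j (subst (L <_) (sym p₂+1≡i) L<i)
    p₁+2≤i : p₁ + + 2 ≤ i
    p₁+2≤i = subst₂ _≤_ (shift-shift p₁ 1 1) p₂+1≡i (ℤP.+-monoˡ-≤ (+ 1) (i<j⇒i+1≤j p₁<p₂))
  ... | inj₂ old₁ | inj₂ old₂ with sep p₁ p₂ p₁<p₂ old₁ old₂
  ...   | j , p₁+3≤j , j+1≤p₂ , oj , oj+1 with j + + 1 ℤP.<? i | i + + 1 ℤP.<? j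
  ...     | yes j+1<i | _ = pair-kept j (inj₁ j+1<i) p₁+3≤j j+1≤p₂ oj oj+1
  ...     | no _ | yes i+1<j = pair-kept j (inj₂ i+1<j) p₁+3≤j j+1≤p₂ oj oj+1
  ...     | no j+1≮i | no i+1≮j =
    OccupiedPairIn-mono p₁+3≤R ℤP.≤-refl
      (pair-right-of-move gaps≤2 sep p₂ old₂
        (surviving-gap2-right-of-move p₂ old₂ eᵇ[p₂+1] (ℤP.≤-trans (ℤP.≮⇒≥ j+1≮i) j+1≤p₂)))
    where
    p₁+3≤R : p₁ + + 3 ≤ R
    p₁+3≤R = ℤP.≤-trans p₁+3≤j (ℤP.<⇒≤ (ℤP.≤-<-trans (ℤP.≮⇒≥ i+1≮j) i+1<R))

Invariant : State → Set
Invariant a = GapsAtMostTwo a × Gap2sSeparated a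

move-preserves-invariant : ∀ {a b} → Move a b → Invariant a → Invariant b
move-preserves-invariant (i , L , R , oᵢ , oᵢ₊₁ , L<i , eL , between-L-i , i+1<R , eR , between-i+1-R , transfer)
  (gaps≤2 , sep) =
  GapsAtMostTwo-preserved gaps≤2 , Gap2sSeparated-preserved gaps≤2 sep
  where open MoveFacts oᵢ oᵢ₊₁ L<i eL between-L-i i+1<R eR between-i+1-R transfer

reachable-preserves-invariant : ∀ {a b} → Reachable a b → Invariant a → Invariant b
reachable-preserves-invariant ε inv = inv
reachable-preserves-invariant (move ◅ moves) inv =
  reachable-preserves-invariant moves (move-preserves-invariant move inv)

clusteron-invariant : ∀ C → Clusteron C → Invariant C
clusteron-invariant C (_ , _ , _ , _ , occupied⇔) = no-triple-gap , no-gap2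
  where
  occupied-between : ∀ {x z y} → Occupied C x → Occupied C y → x < z → z < y → Occupied C z
  occupied-between ox oy x<z z<y = Equivalence.to (occupied⇔ _)
    ( ℤP.≤-trans (proj₁ (Equivalence.from (occupied⇔ _) ox)) (ℤP.<⇒≤ x<z)
    , ℤP.≤-trans (ℤP.<⇒≤ z<y) (proj₂ (Equivalence.from (occupied⇔ _) oy)))
  no-triple-gap : GapsAtMostTwo C
  no-triple-gap x z y ox oy x<z z+2<y e₀ _ _ =
    ℕP.n>0⇒n≢0 (occupied-between ox oy x<z (ℤP.<-trans (i<i+[1+n] z 1) z+2<y)) e₀
  no-gap2 : Gap2sSeparated C
  no-gap2 p₁ _ _ (oₚ , e₁ , _ , o₃) _ =
    ⊥-elim (ℕP.n>0⇒n≢0 (occupied-between oₚ o₃ (i<i+1 p₁) p₁+1<p₁+3) e₁)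
    where
    p₁+1<p₁+3 : p₁ + + 1 < p₁ + + 3
    p₁+1<p₁+3 = ℤP.+-monoʳ-< p₁ (+<+ (s≤s (s≤s z≤n)))

lemma5p4 : (C S : State) → Clusteron C → Reachable C S →
    (p₁ p₂ : ℤ) → p₁ < p₂ → Gap2At S p₁ → Gap2At S p₂ →
    ∃ λ (j : ℤ) → p₁ + + 3 ≤ j × j + + 1 ≤ p₂ × Occupied S j × Occupied S (j + + 1)
lemma5p4 C S clusteron reachable =
  proj₂ (reachable-preserves-invariant reachable (clusteron-invariant C clusteron))
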